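{- Let $G$ be a finite simple graph with vertex set $\{a_1,\ldots,a_v\}$ and let $k\ge 1$. In the reduced $k$th power $G^{(k)}$, the vertex $a_1^{n_1}a_2^{n_2}\cdots a_v^{n_v}$ (where $n_i\ge 0$ and $\sum_i n_i=k$) has degree $$\deg\big(a_1^{n_1}a_2^{n_2}\cdots a_v^{n_v}\big)=\sum_{i:\,n_i\ge 1}\deg_G(a_i).$$
   Context: For a finite simple graph $G$ with vertex set $\{a_1,\ldots,a_v\}$, let $M_k(G)$ denote the set of monic monomials of degree $k$ in the commuting indeterminates $a_1,\ldots,a_v$ (with $M_0(G)=\{1\}$). The reduced $k$th power $G^{(k)}$ is the graph with vertex set $M_k(G)$ in which, for every edge $a_ia_j$ of $G$ and every $f\in M_{k-1}(G)$, the vertex $a_if$ is adjacent to $a_jf$ (and these are the only edges). Equivalently, $G^{(k)}$ is the quotient of the $k$-fold Cartesian power $G\Box\cdots\Box G$ by the action of the symmetric group $S_k$ permuting coordinates; it can be viewed as the space of configurations of $k$ indistinguishable tokens on the vertices of $G$ (several tokens allowed per vertex), two configurations being adjacent if one is obtained from the other by moving one token along an edge of $G$. -}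

module Defs where

open import Data.Nat using (ℕ; zero; suc; _+_; _∸_; _≤_; _≤ᵇ_)
open import Data.Bool using (Bool; true; false; if_then_else_)
open import Data.Fin using (Fin; _≟_)
open import Data.List using (List; length; map; filter; allFin)
open import Data.Nat.ListAction using () renaming (sum to listSum)
import Data.List as List
open import Data.List.Relation.Unary.Unique.Propositional using (Unique)
open import Data.List.Membership.Propositional using (_∈_)
open import Data.Vec using (Vec; lookup; tabulate; zipWith)
import Data.Vec as Vec
open import Data.Product using (Σ; Σ-syntax; _×_; ∃-syntax)
open import Relation.Binary.PropositionalEquality using (_≡_)
open import Relation.Nullary using (does)
open import Function.Bundles using (_⇔_)

record SimpleGraph (v : ℕ) : Set where
  field
    adj     : Fin v → Fin v → Bool
    symm    : ∀ i j → adj i j ≡ adj j i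
    irrefl  : ∀ i → adj i i ≡ false

open SimpleGraph public

degG : ∀ {v} → SimpleGraph v → Fin v → ℕ
degG {v} G i = length (filter (λ j → adj G i j ≟ᵇ true) (allFin v))
  where
    open import Data.Bool.Properties using () renaming (_≟_ to _≟ᵇ_)

-- Monomials a_1^{n_1}⋯a_v^{n_v} are represented by exponent vectors.
Monomial : ℕ → Set
Monomial v = Vec ℕ v

totalDeg : ∀ {v} → Monomial v → ℕ
totalDeg = Vec.sum

InM : ∀ {v} → ℕ → Monomial v → Set
InM k m = totalDeg m ≡ k

var : ∀ {v} → Fin v → Monomial v
var i = tabulate (λ j → if does (i ≟ j) then 1 else 0)

_·_ : ∀ {v} → Monomial v → Monomial v → Monomial v
_·_ = zipWith _+_

PowAdj : ∀ {v} → SimpleGraph v → ℕ → Monomial v → Monomial v → Set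
PowAdj {v} G k m m' =
  Σ[ i ∈ Fin v ] Σ[ j ∈ Fin v ] Σ[ f ∈ Monomial v ]
    (adj G i j ≡ true) × InM (k ∸ 1) f × (m ≡ var i · f) × (m' ≡ var j · f)

HasCard : {A : Set} → (A → Set) → ℕ → Set
HasCard {A} P d = Σ[ xs ∈ List A ] Unique xs × (∀ y → (y ∈ xs) ⇔ P y) × (length xs ≡ d)

-- degree of m in G^(k) is d: the set of neighbours of m in G^(k) has d elements
-- (neighbours m' automatically lie in M_k when m does).
PowDegree : ∀ {v} → SimpleGraph v → ℕ → Monomial v → ℕ → Set
PowDegree G k m d = HasCard (λ m' → InM k m' × PowAdj G k m m') d

supportDegSum : ∀ {v} → SimpleGraph v → Monomial v → ℕ
supportDegSum {v} G n =
  listSum (map (λ i → if 1 ≤ᵇ lookup n i then degG G i else 0) (allFin v))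

module Submission where

-- A neighbour of the monomial n in G^(k) is obtained by moving one token
-- from a vertex a_i occupied by n (n_i ≥ 1) to a G-neighbour a_j, i.e. it
-- is the monomial a_j · (n / a_i).  We therefore list the "moves"
--   (i , j)  with  n_i ≥ 1  and  a_i a_j ∈ E(G)
-- and map each move to its target monomial.  The theorem follows from:
--   * the targets are exactly the neighbours of n (division by a variable
--     is possible precisely when its exponent is positive, and is unique);
--   * distinct moves give distinct targets, because a move with i ≠ j is
--     determined by its source and target monomials (coordinate j rises,
--     coordinate i drops);
--   * the number of moves is Σ_{n_i ≥ 1} deg_G(a_i), by counting the moves
--     row by row (a general fact about filtering a Cartesian product).

open import Defs
open import Data.Nat using (ℕ; suc; _+_; _∸_; _≤_; z≤n; s≤s)
open import Data.Nat.Properties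
  using (_≤?_; +-commutativeSemigroup; +-assoc; +-comm; +-suc; +-cancelʳ-≡; m+n∸m≡n; m+[n∸m]≡n; m≢1+n+m; 1+n≢0)
open import Data.Bool using (true; false; if_then_else_)
open import Data.Bool.Properties using () renaming (_≟_ to _≟ᵇ_)
open import Data.Fin using (Fin; zero; suc; _≟_)
open import Data.List using (List; []; _∷_; _++_; length; map; filter; allFin; cartesianProduct)
open import Data.Nat.ListAction using () renaming (sum to listSum)
open import Data.List.Properties using (length-map; length-++; filter-++; filter-none)
open import Data.List.Relation.Unary.All using (All; []; _∷_)
import Data.List.Relation.Unary.All as All
open import Data.List.Relation.Unary.All.Properties using (all-filter)
import Data.List.Relation.Unary.All.Properties as AllP
open import Data.List.Relation.Unary.AllPairs using ([]; _∷_)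
open import Data.List.Relation.Unary.Unique.Propositional using (Unique)
open import Data.List.Relation.Unary.Unique.Propositional.Properties
  using (cartesianProduct⁺; allFin⁺; filter⁺)
open import Data.List.Membership.Propositional using (_∈_)
open import Data.List.Membership.Propositional.Properties
  using (∈-map⁺; ∈-map⁻; ∈-filter⁺; ∈-filter⁻; ∈-cartesianProduct⁺; ∈-allFin)
open import Data.Vec using ([]; _∷_; lookup; tabulate; zipWith)
open import Data.Vec.Properties
  using (lookup-zipWith; lookup∘tabulate; tabulate∘lookup; tabulate-cong; zipWith-assoc; zipWith-comm)
open import Data.Product using (Σ; _×_; _,_; proj₁; proj₂)
open import Relation.Binary.PropositionalEquality
  using (_≡_; _≢_; refl; sym; trans; cong; cong₂; subst; module ≡-Reasoning)
open import Relation.Nullary using (Dec; does; yes; no; _×-dec_; contradiction)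
open import Relation.Nullary.Decidable using (dec-true; dec-false)
open import Relation.Unary using (Decidable)
open import Function using (_∘_)
open import Function.Bundles using (_⇔_; mk⇔; Equivalence)
open import Algebra.Properties.CommutativeSemigroup +-commutativeSemigroup using (interchange)

monomial-ext : ∀ {v} {m m′ : Monomial v} → (∀ l → lookup m l ≡ lookup m′ l) → m ≡ m′
monomial-ext {m = m} {m′} eq =
  trans (sym (tabulate∘lookup m)) (trans (tabulate-cong eq) (tabulate∘lookup m′))

lookup-· : ∀ {v} (m m′ : Monomial v) l → lookup (m · m′) l ≡ lookup m l + lookup m′ l
lookup-· m m′ l = lookup-zipWith _+_ l m m′

lookup-var-self : ∀ {v} (i : Fin v) → lookup (var i) i ≡ 1
lookup-var-self i =
  trans (lookup∘tabulate _ i) (cong (if_then 1 else 0) (dec-true (i ≟ i) refl))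

lookup-var-other : ∀ {v} {i l : Fin v} → i ≢ l → lookup (var i) l ≡ 0
lookup-var-other {i = i} {l} i≢l =
  trans (lookup∘tabulate _ l) (cong (if_then 1 else 0) (dec-false (i ≟ l) i≢l))

var-·-exchange : ∀ {v} (i j : Fin v) (g : Monomial v) → var i · (var j · g) ≡ var j · (var i · g)
var-·-exchange i j g = begin
  var i · (var j · g)  ≡⟨ sym (zipWith-assoc +-assoc (var i) (var j) g) ⟩
  (var i · var j) · g  ≡⟨ cong (_· g) (zipWith-comm +-comm (var i) (var j)) ⟩
  (var j · var i) · g  ≡⟨ zipWith-assoc +-assoc (var j) (var i) g ⟩
  var j · (var i · g)  ∎
  where open ≡-Reasoning

totalDeg-· : ∀ {v} (m m′ : Monomial v) → totalDeg (m · m′) ≡ totalDeg m + totalDeg m′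
totalDeg-· [] [] = refl
totalDeg-· (x ∷ m) (y ∷ m′) =
  trans (cong (x + y +_) (totalDeg-· m m′)) (interchange x y (totalDeg m) (totalDeg m′))

totalDeg-var : ∀ {v} (i : Fin v) → totalDeg (var i) ≡ 1
totalDeg-var {suc v} zero = cong suc (totalDeg-zero v)
  where
  totalDeg-zero : ∀ w → totalDeg (tabulate {n = w} (λ _ → 0)) ≡ 0
  totalDeg-zero 0 = refl
  totalDeg-zero (suc w) = totalDeg-zero w
totalDeg-var (suc i) = totalDeg-var i

totalDeg-var· : ∀ {v} (i : Fin v) (g : Monomial v) → totalDeg (var i · g) ≡ suc (totalDeg g)
totalDeg-var· i g = trans (totalDeg-· (var i) g) (cong (_+ totalDeg g) (totalDeg-var i))

coordinate : ∀ {v} (i j : Fin v) (m n : Monomial v) → var i · m ≡ var j · n →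
             ∀ l → lookup (var i) l + lookup m l ≡ lookup (var j) l + lookup n l
coordinate i j m n eq l =
  trans (sym (lookup-· (var i) m l)) (trans (cong (λ x → lookup x l) eq) (lookup-· (var j) n l))

-- The quotient n / a_i, meaningful when a_i divides n.
_÷_ : ∀ {v} → Monomial v → Fin v → Monomial v
n ÷ i = zipWith _∸_ n (var i)

var·÷ : ∀ {v} (n : Monomial v) (i : Fin v) → 1 ≤ lookup n i → var i · (n ÷ i) ≡ n
var·÷ n i 1≤nᵢ = monomial-ext λ l → begin
  lookup (var i · (n ÷ i)) l                         ≡⟨ lookup-· (var i) (n ÷ i) l ⟩
  lookup (var i) l + lookup (n ÷ i) l                ≡⟨ cong (lookup (var i) l +_) (lookup-zipWith _∸_ l n (var i)) ⟩
  lookup (var i) l + (lookup n l ∸ lookup (var i) l) ≡⟨ m+[n∸m]≡n (var-≤ l) ⟩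
  lookup n l                                         ∎
  where
  open ≡-Reasoning
  var-≤ : ∀ l → lookup (var i) l ≤ lookup n l
  var-≤ l with i ≟ l
  ... | yes refl = subst (_≤ lookup n i) (sym (lookup-var-self i)) 1≤nᵢ
  ... | no i≢l   = subst (_≤ lookup n l) (sym (lookup-var-other i≢l)) z≤n

divisible : ∀ {v} (i : Fin v) {g n : Monomial v} → var i · g ≡ n → 1 ≤ lookup n i
divisible i {g} {n} eq = subst (1 ≤_) 1+gᵢ≡nᵢ (s≤s z≤n)
  where
  open ≡-Reasoning
  1+gᵢ≡nᵢ : 1 + lookup g i ≡ lookup n i
  1+gᵢ≡nᵢ = begin
    1 + lookup g i                ≡⟨ cong (_+ lookup g i) (lookup-var-self i) ⟨
    lookup (var i) i + lookup g i ≡⟨ lookup-· (var i) g i ⟨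
    lookup (var i · g) i          ≡⟨ cong (λ x → lookup x i) eq ⟩
    lookup n i                    ∎

÷-unique : ∀ {v} (i : Fin v) {g n : Monomial v} → var i · g ≡ n → g ≡ n ÷ i
÷-unique i {g} {n} eq = monomial-ext λ l → sym (begin
  lookup (n ÷ i) l                                   ≡⟨ lookup-zipWith _∸_ l n (var i) ⟩
  lookup n l ∸ lookup (var i) l                      ≡⟨ cong (λ x → lookup x l ∸ lookup (var i) l) (sym eq) ⟩
  lookup (var i · g) l ∸ lookup (var i) l            ≡⟨ cong (_∸ lookup (var i) l) (lookup-· (var i) g l) ⟩
  lookup (var i) l + lookup g l ∸ lookup (var i) l   ≡⟨ m+n∸m≡n (lookup (var i) l) (lookup g l) ⟩
  lookup g l                                         ∎)
  where open ≡-Reasoning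

totalDeg-÷ : ∀ {v} {k} (n : Monomial v) (i : Fin v) → InM k n → 1 ≤ lookup n i → InM (k ∸ 1) (n ÷ i)
totalDeg-÷ n i deg-n 1≤nᵢ =
  cong (_∸ 1) (trans (sym (totalDeg-var· i (n ÷ i))) (trans (cong totalDeg (var·÷ n i 1≤nᵢ)) deg-n))

move-determined : ∀ {v} (i j i′ j′ : Fin v) (m n : Monomial v) → i ≢ j →
                  var i · m ≡ var j · n → var i′ · m ≡ var j′ · n → i ≡ i′ × j ≡ j′
move-determined i j i′ j′ m n i≢j eq eq′ = i≡i′ , j≡j′
  where
  open ≡-Reasoning
  mⱼ : lookup m j ≡ suc (lookup n j)
  mⱼ = begin
    lookup m j                      ≡⟨ cong (_+ lookup m j) (lookup-var-other i≢j) ⟨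
    lookup (var i) j + lookup m j   ≡⟨ coordinate i j m n eq j ⟩
    lookup (var j) j + lookup n j   ≡⟨ cong (_+ lookup n j) (lookup-var-self j) ⟩
    suc (lookup n j)                ∎
  j≡j′ : j ≡ j′
  j≡j′ with j′ ≟ j
  ... | yes j′≡j = sym j′≡j
  ... | no j′≢j  = contradiction (begin
          lookup n j                              ≡⟨ cong (_+ lookup n j) (lookup-var-other j′≢j) ⟨
          lookup (var j′) j + lookup n j          ≡⟨ coordinate i′ j′ m n eq′ j ⟨
          lookup (var i′) j + lookup m j          ≡⟨ cong (lookup (var i′) j +_) mⱼ ⟩
          lookup (var i′) j + suc (lookup n j)    ≡⟨ +-suc (lookup (var i′) j) (lookup n j) ⟩
          suc (lookup (var i′) j + lookup n j)    ∎)
        (m≢1+n+m (lookup n j))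
  same-at-i : lookup (var i) i ≡ lookup (var i′) i
  same-at-i = +-cancelʳ-≡ (lookup m i) _ _ (begin
    lookup (var i) i + lookup m i    ≡⟨ coordinate i j m n eq i ⟩
    lookup (var j) i + lookup n i    ≡⟨ cong (λ x → lookup (var x) i + lookup n i) j≡j′ ⟩
    lookup (var j′) i + lookup n i   ≡⟨ coordinate i′ j′ m n eq′ i ⟨
    lookup (var i′) i + lookup m i   ∎)
  i≡i′ : i ≡ i′
  i≡i′ with i′ ≟ i
  ... | yes i′≡i = sym i′≡i
  ... | no i′≢i  = contradiction
          (trans (sym (lookup-var-self i)) (trans same-at-i (lookup-var-other i′≢i))) 1+n≢0

module CountProduct {A B : Set} {P : A → Set} {R : A → B → Set}
                    (P? : Decidable P) (R? : ∀ a → Decidable (R a)) where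

  S? : (p : A × B) → Dec (P (proj₁ p) × R (proj₁ p) (proj₂ p))
  S? (a , b) = P? a ×-dec R? a b

  row-accepted : ∀ {a} → P a → ∀ ys → filter S? (map (a ,_) ys) ≡ map (a ,_) (filter (R? a) ys)
  row-accepted pa [] = refl
  row-accepted {a} pa (y ∷ ys) rewrite dec-true (P? a) pa with does (R? a y)
  ... | true  = cong ((a , y) ∷_) (row-accepted pa ys)
  ... | false = row-accepted pa ys

  row-length : ∀ a ys → length (filter S? (map (a ,_) ys)) ≡ (if does (P? a) then length (filter (R? a) ys) else 0)
  row-length a ys with P? a
  ... | yes pa = trans (cong length (row-accepted pa ys)) (length-map (a ,_) (filter (R? a) ys))
  ... | no ¬pa = cong length (filter-none S? (AllP.map⁺ (All.universal (λ _ → ¬pa ∘ proj₁) ys)))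

  length-filter-product : ∀ xs ys →
    length (filter S? (cartesianProduct xs ys))
      ≡ listSum (map (λ a → if does (P? a) then length (filter (R? a) ys) else 0) xs)
  length-filter-product [] ys = refl
  length-filter-product (x ∷ xs) ys = begin
    length (filter S? (map (x ,_) ys ++ cartesianProduct xs ys))
      ≡⟨ cong length (filter-++ S? (map (x ,_) ys) (cartesianProduct xs ys)) ⟩
    length (filter S? (map (x ,_) ys) ++ filter S? (cartesianProduct xs ys))
      ≡⟨ length-++ (filter S? (map (x ,_) ys)) ⟩
    length (filter S? (map (x ,_) ys)) + length (filter S? (cartesianProduct xs ys))
      ≡⟨ cong₂ _+_ (row-length x ys) (length-filter-product xs ys) ⟩
    _ ∎
    where open ≡-Reasoning

unique-map-injectiveOn : ∀ {A B : Set} {P : A → Set} (f : A → B) →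
  (∀ {x y} → P x → P y → f x ≡ f y → x ≡ y) →
  ∀ {xs} → All P xs → Unique xs → Unique (map f xs)
unique-map-injectiveOn f inj [] [] = []
unique-map-injectiveOn f inj (px ∷ pxs) (x∉xs ∷ uxs) =
  AllP.map⁺ (All.zipWith (λ (py , x≢y) fx≡fy → x≢y (inj px py fx≡fy)) (pxs , x∉xs))
  ∷ unique-map-injectiveOn f inj pxs uxs

module Moves {v} (G : SimpleGraph v) (n : Monomial v) where

  Move : Fin v × Fin v → Set
  Move (i , j) = 1 ≤ lookup n i × adj G i j ≡ true

  Move? : ∀ p → Dec (Move p)
  Move? = CountProduct.S? (λ i → 1 ≤? lookup n i) (λ i j → adj G i j ≟ᵇ true)

  pairs : List (Fin v × Fin v)
  pairs = cartesianProduct (allFin v) (allFin v)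

  moves : List (Fin v × Fin v)
  moves = filter Move? pairs

  target : Fin v × Fin v → Monomial v
  target (i , j) = var j · (n ÷ i)

  length-moves : length moves ≡ supportDegSum G n
  length-moves = CountProduct.length-filter-product
    (λ i → 1 ≤? lookup n i) (λ i j → adj G i j ≟ᵇ true) (allFin v) (allFin v)

  moves-unique : Unique moves
  moves-unique = filter⁺ Move? (cartesianProduct⁺ (allFin⁺ v) (allFin⁺ v))

  ∈-moves : ∀ {p} → p ∈ moves ⇔ Move p
  ∈-moves {i , j} = mk⇔ (proj₂ ∘ ∈-filter⁻ Move? {xs = pairs})
                        (∈-filter⁺ Move? (∈-cartesianProduct⁺ (∈-allFin i) (∈-allFin j)))

  edge-ends-distinct : ∀ {i j} → adj G i j ≡ true → i ≢ j
  edge-ends-distinct {i} aᵢⱼ refl with trans (sym aᵢⱼ) (irrefl G i)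
  ... | ()

  target-moved : ∀ i j → 1 ≤ lookup n i → var i · target (i , j) ≡ var j · n
  target-moved i j 1≤nᵢ =
    trans (var-·-exchange i j (n ÷ i)) (cong (var j ·_) (var·÷ n i 1≤nᵢ))

  target-injective : ∀ {p q} → Move p → Move q → target p ≡ target q → p ≡ q
  target-injective {i , j} {i′ , j′} (1≤nᵢ , aᵢⱼ) (1≤nᵢ′ , _) eq =
    let (i≡i′ , j≡j′) = move-determined i j i′ j′ (target (i , j)) n (edge-ends-distinct aᵢⱼ)
                          (target-moved i j 1≤nᵢ)
                          (subst (λ m → var i′ · m ≡ var j′ · n) (sym eq) (target-moved i′ j′ 1≤nᵢ′))
    in cong₂ _,_ i≡i′ j≡j′

  target-neighbour : ∀ {k p} → 1 ≤ k → InM k n → Move p → InM k (target p) × PowAdj G k n (target p)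
  target-neighbour {k} {i , j} 1≤k deg-n (1≤nᵢ , aᵢⱼ) =
    deg-target , i , j , n ÷ i , aᵢⱼ , totalDeg-÷ n i deg-n 1≤nᵢ , sym (var·÷ n i 1≤nᵢ) , refl
    where
    deg-target : InM k (var j · (n ÷ i))
    deg-target = trans (totalDeg-var· j (n ÷ i))
                       (trans (cong suc (totalDeg-÷ n i deg-n 1≤nᵢ)) (m+[n∸m]≡n 1≤k))

  neighbour-target : ∀ k {m} → PowAdj G k n m → Σ (Fin v × Fin v) λ p → Move p × m ≡ target p
  neighbour-target k (i , j , _ , aᵢⱼ , _ , n≡ , m≡) =
    (i , j) , (divisible i (sym n≡) , aᵢⱼ) , trans m≡ (cong (var j ·_) (÷-unique i (sym n≡)))

  neighbours : List (Monomial v)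
  neighbours = map target moves

  neighbours-unique : Unique neighbours
  neighbours-unique = unique-map-injectiveOn target target-injective (all-filter Move? pairs) moves-unique

  length-neighbours : length neighbours ≡ supportDegSum G n
  length-neighbours = trans (length-map target moves) length-moves

  ∈-neighbours : ∀ {k m} → 1 ≤ k → InM k n → m ∈ neighbours ⇔ (InM k m × PowAdj G k n m)
  ∈-neighbours {k} {m} 1≤k deg-n = mk⇔ sound complete
    where
    sound : m ∈ neighbours → InM k m × PowAdj G k n m
    sound m∈ with ∈-map⁻ target m∈
    ... | p , p∈moves , refl = target-neighbour 1≤k deg-n (Equivalence.to ∈-moves p∈moves)
    complete : InM k m × PowAdj G k n m → m ∈ neighbours
    complete (_ , n~m) with neighbour-target k n~m
    ... | p , move , refl = ∈-map⁺ target (Equivalence.from ∈-moves move)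

proposition1 : ∀ {v : ℕ} (G : SimpleGraph v) (k : ℕ) → 1 ≤ k →
    (n : Monomial v) → InM k n →
    PowDegree G k n (supportDegSum G n)
proposition1 G k 1≤k n deg-n =
  neighbours , neighbours-unique , (λ _ → ∈-neighbours 1≤k deg-n) , length-neighbours
  where open Moves G n
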